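{- Let $\mathcal T$ be a tangle of order $k$ in a connectivity system $(E,\lambda)$, and let $X$ be a $\mathcal T$-strong $k$-separating set. If $X_1$ and $X_2$ are fully closed $k$-separating sets that contain $X$, then there is a fully closed $k$-separating set $Y$ such that $X\subseteq Y\subseteq X_1\cap X_2$.
   Context: A connectivity system is a pair $(E,\lambda)$ with $E$ finite and $\lambda$ an integer-valued symmetric ($\lambda(X)=\lambda(E-X)$) submodular ($\lambda(X)+\lambda(Y)\ge\lambda(X\cup Y)+\lambda(X\cap Y)$) function on subsets of $E$. $X$ is $k$-separating if $\lambda(X)\le k$. A tangle of order $k$ is a collection $\mathcal T$ of subsets of $E$ with (T1) $\lambda(A)<k$ for $A\in\mathcal T$; (T2) if $\lambda(A)\le k-1$ then $A\in\mathcal T$ or $E-A\in\mathcal T$; (T3) no three members of $\mathcal T$ have union $E$; (T4) $E-\{e\}\notin\mathcal T$ for $e\in E$. $X$ is $\mathcal T$-weak if contained in a member of $\mathcal T$, else $\mathcal T$-strong. A $\mathcal T$-strong $k$-separating set $X$ is fully closed (with respect to $\mathcal T$) if there is no non-empty $\mathcal T$-weak set $Y\subseteq E-X$ such that $X\cup Y$ is $k$-separating. -}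

module Defs where

open import Data.Nat using (ℕ)
open import Data.Integer using (ℤ; _≤_; _<_; _-_; +_; _+_)
open import Data.Fin.Subset using (Subset; _∪_; _∩_; ∁; ⊤; _⊆_; Nonempty)
open import Data.Fin using (Fin)
open import Data.Product using (_×_; ∃)
open import Data.Sum using (_⊎_)
open import Relation.Nullary using (¬_)
open import Relation.Binary.PropositionalEquality using (_≡_)

record ConnectivitySystem (n : ℕ) : Set where
  field
    λc        : Subset n → ℤ
    symmetric : ∀ X → λc X ≡ λc (∁ X)
    submod    : ∀ X Y → λc (X ∪ Y) + λc (X ∩ Y) ≤ λc X + λc Y

open ConnectivitySystem public

module _ {n : ℕ} (C : ConnectivitySystem n) where

  Separating : ℤ → Subset n → Set
  Separating k X = λc C X ≤ k

  record IsTangle (k : ℤ) (𝒯 : Subset n → Set) : Set where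
    field
      T1 : ∀ A → 𝒯 A → λc C A < k
      T2 : ∀ A → λc C A ≤ k - + 1 → 𝒯 A ⊎ 𝒯 (∁ A)
      T3 : ∀ A B D → 𝒯 A → 𝒯 B → 𝒯 D → ¬ (A ∪ B ∪ D ≡ ⊤)
      T4 : ∀ (e : Fin n) → ¬ 𝒯 (⊤ Data.Fin.Subset.- e)

  Weak : (Subset n → Set) → Subset n → Set
  Weak 𝒯 X = ∃ λ A → 𝒯 A × X ⊆ A

  Strong : (Subset n → Set) → Subset n → Set
  Strong 𝒯 X = ¬ Weak 𝒯 X

  FullyClosed : ℤ → (Subset n → Set) → Subset n → Set
  FullyClosed k 𝒯 X =
    Strong 𝒯 X × Separating k X ×
    (∀ Y → Nonempty Y → Weak 𝒯 Y → Y ⊆ ∁ X → ¬ Separating k (X ∪ Y))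

-- Among the k-separating sets Y with X ⊆ Y ⊆ X₁ ∩ X₂ choose a
-- ⊆-maximal one (the ground set is finite).  Y is strong because X is.
-- Suppose a non-empty weak W disjoint from Y had λ(Y ∪ W) ≤ k, and put
-- U = Y ∪ W.  For a fully closed X' ⊇ Y, the part of U outside X' lies in W,
-- hence is weak, and submodularity together with the closure of X' gives
-- λ(U ∩ X') ≤ λ(U), strictly if U ⊄ X'.  Applying this to X₁ and then X₂
-- shows that U ∩ X₁ ∩ X₂ is k-separating, so by maximality it equals Y;
-- since some w ∈ W escapes X₁ or X₂, in fact λ(Y) < k.  Tangle axiom (T2)
-- then puts Y or its complement in the tangle: the first contradicts
-- strength of Y, the second makes the complement of a proper fully closed
-- set weak, contradicting its closure because λ(E) ≤ λ(X') ≤ k.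
module Submission where

open import Defs
open import Data.Nat using (ℕ)
open import Data.Integer using (ℤ)
open import Data.Fin.Subset using (Subset; _∩_; _⊆_)
open import Data.Product using (_×_; ∃)

import Data.Nat as ℕ
import Data.Nat.Properties as ℕP
open import Data.Integer using (_≤_; _<_; _+_; +_; _-_; -1ℤ)
open import Data.Integer.Properties
  using (≤-refl; ≤-trans; ≤-reflexive; <⇒≤; <-irrefl; ≤-<-trans; <-≤-trans;
         ≰⇒>; ≮⇒≥; +-mono-≤; +-mono-<; +-mono-<-≤; +-comm; i<j⇒i≤pred[j]; _≤?_)
open import Data.Fin.Subset using (_∪_; ∁; ⊤; ⊥; _∈_; _∉_; Nonempty; ∣_∣)
open import Data.Fin.Subset.Properties
  using (_∈?_; _⊆?_; _⊂?_; anySubset?; ∣p∣≤n; p⊂q⇒∣p∣<∣q∣; p⊂q⇒p⊆q;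
         ⊆-refl; ⊆-trans; ⊆-antisym; ⊆⊤; ∉⊥; p∩q⊆p; p∩q⊆q; x∈p∩q⁺; x∈p∩q⁻;
         x∈p∪q⁻; p⊆p∪q; q⊆p∪q; x∉p⇒x∈∁p; x∈∁p⇒x∉p; p⊆q⇒∁p⊇∁q; p∪∁p≡⊤;
         ∩-comm; ∩-identityʳ; ∩-inverseʳ; ∪-distribˡ-∩)
open import Data.Fin.Properties using (any?)
open import Data.Product using (_,_; proj₁; proj₂)
open import Data.Sum using (_⊎_; inj₁; inj₂; [_,_]′)
open import Data.Empty using (⊥-elim)
import Data.Empty as Empty
open import Function using (id; _∘_)
open import Relation.Nullary using (¬_; yes; no; contradiction)
open import Relation.Nullary.Decidable using (_×-dec_; ¬?; decidable-stable)
open import Relation.Unary using (Pred; Decidable)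
open import Relation.Binary.PropositionalEquality
  using (_≡_; refl; sym; cong; subst; module ≡-Reasoning)

half-≤ : ∀ {a b : ℤ} → a + a ≤ b + b → a ≤ b
half-≤ h = ≮⇒≥ (λ b<a → <-irrefl refl (<-≤-trans (+-mono-< b<a b<a) h))

-- The shape of every submodularity argument below: if
-- λ(P ∪ Q) + λ(P ∩ Q) ≤ λ(P) + λ(Q) with λ(P) ≤ k < λ(P ∪ Q),
-- then λ(P ∩ Q) < λ(Q).
submod-drop : ∀ {k a b c d : ℤ} → a + b ≤ c + d → c ≤ k → k < a → b < d
submod-drop h c≤k k<a = ≰⇒> λ d≤b →
  <-irrefl refl (<-≤-trans (≤-<-trans (+-mono-≤ c≤k d≤b) (+-mono-<-≤ k<a ≤-refl)) h)

-- Integer order: a < k means a ≤ k - 1, the form used by tangle axiom (T2).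
<⇒≤-1 : ∀ {a k : ℤ} → a < k → a ≤ k - + 1
<⇒≤-1 {a} {k} a<k = subst (a ≤_) (+-comm -1ℤ k) (i<j⇒i≤pred[j] a<k)

module _ {n : ℕ} where

  ⊆-or-escape : (U X : Subset n) → U ⊆ X ⊎ ∃ λ x → x ∈ U × x ∉ X
  ⊆-or-escape U X with any? (λ x → (x ∈? U) ×-dec ¬? (x ∈? X))
  ... | yes escape = inj₂ escape
  ... | no ¬escape = inj₁ λ {x} x∈U →
    decidable-stable (x ∈? X) (λ x∉X → ¬escape (x , x∈U , x∉X))

  ∉∩ : ∀ {x} (X₁ X₂ : Subset n) → x ∉ X₁ ∩ X₂ → x ∉ X₁ ⊎ x ∉ X₂
  ∉∩ {x} X₁ X₂ x∉X₁∩X₂ with x ∈? X₁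
  ... | no x∉X₁  = inj₁ x∉X₁
  ... | yes x∈X₁ = inj₂ λ x∈X₂ → x∉X₁∩X₂ (x∈p∩q⁺ (x∈X₁ , x∈X₂))

  outside-⊆ : ∀ {V Y W X : Subset n} → V ⊆ Y ∪ W → Y ⊆ X → V ∩ ∁ X ⊆ W
  outside-⊆ {V} {Y} {W} {X} V⊆Y∪W Y⊆X x∈V∖X with x∈p∩q⁻ V (∁ X) x∈V∖X
  ... | x∈V , x∈∁X =
    [ (λ x∈Y → contradiction (Y⊆X x∈Y) (x∈∁p⇒x∉p x∈∁X)) , id ]′ (x∈p∪q⁻ Y W (V⊆Y∪W x∈V))

  ∪-outside : (X U : Subset n) → X ∪ (U ∩ ∁ X) ≡ X ∪ U
  ∪-outside X U = begin
    X ∪ (U ∩ ∁ X)         ≡⟨ ∪-distribˡ-∩ X U (∁ X) ⟩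
    (X ∪ U) ∩ (X ∪ ∁ X)   ≡⟨ cong ((X ∪ U) ∩_) (p∪∁p≡⊤ X) ⟩
    (X ∪ U) ∩ ⊤           ≡⟨ ∩-identityʳ (X ∪ U) ⟩
    X ∪ U                 ∎
    where open ≡-Reasoning

  ∁⊥≡⊤ : ∁ ⊥ ≡ ⊤ {n}
  ∁⊥≡⊤ = ⊆-antisym ⊆⊤ (λ _ → x∉p⇒x∈∁p ∉⊥)

  Maximal : ∀ {ℓ} → Pred (Subset n) ℓ → Subset n → Set ℓ
  Maximal P Y = P Y × (∀ Z → Y ⊆ Z → P Z → Z ⊆ Y)

  -- Every set satisfying a decidable predicate lies below a maximal one:
  -- keep passing to a strictly larger set satisfying P; the size bound
  -- ∣ Y ∣ ≤ n (as fuel) ends the ascent.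
  maximal-above : ∀ {ℓ} {P : Pred (Subset n) ℓ} → Decidable P →
                  ∀ {X} → P X → ∃ λ Y → Maximal P Y × X ⊆ Y
  maximal-above {P = P} P? {X} PX = climb (ℕ.suc n) X (ℕP.m≤m+n (ℕ.suc n) _) PX
    where
    climb : (fuel : ℕ) (Y : Subset n) → n ℕ.< fuel ℕ.+ ∣ Y ∣ → P Y →
            ∃ λ Z → Maximal P Z × Y ⊆ Z
    climb ℕ.zero Y bound _ = ⊥-elim (ℕP.<⇒≱ bound (∣p∣≤n Y))
    climb (ℕ.suc fuel) Y bound PY with anySubset? (λ Z → (Y ⊂? Z) ×-dec P? Z)
    ... | yes (Z , Y⊂Z , PZ) =
      let (M , maxM , Z⊆M) = climb fuel Z bound′ PZ
      in M , maxM , ⊆-trans (p⊂q⇒p⊆q Y⊂Z) Z⊆M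
      where
      bound′ : n ℕ.< fuel ℕ.+ ∣ Z ∣
      bound′ = ℕP.<-≤-trans bound (ℕP.≤-trans (ℕP.≤-reflexive (sym (ℕP.+-suc fuel _)))
                                              (ℕP.+-monoʳ-≤ fuel (p⊂q⇒∣p∣<∣q∣ Y⊂Z)))
    ... | no noLarger = Y , (PY , below) , ⊆-refl
      where
      below : ∀ Z → Y ⊆ Z → P Z → Z ⊆ Y
      below Z Y⊆Z PZ = [ id , (λ (x , x∈Z , x∉Y) →
        ⊥-elim (noLarger (Z , (Y⊆Z , x , x∈Z , x∉Y) , PZ))) ]′ (⊆-or-escape Z Y)

module _ {n : ℕ} (C : ConnectivitySystem n) where

  private
    λ′ : Subset n → ℤ
    λ′ = λc C

  -- The whole ground set has the least connectivity: λ(E) ≤ λ(X), by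
  -- submodularity for X and its complement, since λ(∅) = λ(E).
  λ-⊤-least : (X : Subset n) → λ′ ⊤ ≤ λ′ X
  λ-⊤-least X = half-≤ (submod-X-∁X (submod C X (∁ X)))
    where
    λ⊥≡λ⊤ : λ′ (X ∩ ∁ X) ≡ λ′ ⊤
    λ⊥≡λ⊤ = begin
      λ′ (X ∩ ∁ X) ≡⟨ cong λ′ (∩-inverseʳ X) ⟩
      λ′ ⊥         ≡⟨ symmetric C ⊥ ⟩
      λ′ (∁ ⊥)     ≡⟨ cong λ′ ∁⊥≡⊤ ⟩
      λ′ ⊤         ∎
      where open ≡-Reasoning
    submod-X-∁X : λ′ (X ∪ ∁ X) + λ′ (X ∩ ∁ X) ≤ λ′ X + λ′ (∁ X) → λ′ ⊤ + λ′ ⊤ ≤ λ′ X + λ′ X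
    submod-X-∁X h rewrite p∪∁p≡⊤ X | λ⊥≡λ⊤ | sym (symmetric C X) = h

  module _ (k : ℤ) (𝒯 : Subset n → Set) where

    weak-⊆ : ∀ {V W} → V ⊆ W → Weak C 𝒯 W → Weak C 𝒯 V
    weak-⊆ V⊆W (A , A∈𝒯 , W⊆A) = A , A∈𝒯 , W⊆A ∘ V⊆W

    strong-⊇ : ∀ {V W} → V ⊆ W → Strong C 𝒯 V → Strong C 𝒯 W
    strong-⊇ V⊆W strongV = strongV ∘ weak-⊆ V⊆W

    -- The complement of a fully closed set X ≠ E is strong: otherwise it could
    -- be added to X, but X ∪ ∁ X = E has λ(E) ≤ λ(X) ≤ k.
    complement-strong : ∀ {X w} → FullyClosed C k 𝒯 X → w ∉ X → Strong C 𝒯 (∁ X)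
    complement-strong {X} {w} (_ , sepX , closed) w∉X weak∁X =
      closed (∁ X) (w , x∉p⇒x∈∁p w∉X) weak∁X ⊆-refl
        (subst (λ Z → λ′ Z ≤ k) (sym (p∪∁p≡⊤ X)) (≤-trans (λ-⊤-least X) sepX))

    -- Adding that part to X
    -- gives X ∪ U, which is not k-separating; apply submodularity to X, U.
    shrink-strict : ∀ {X U w} → FullyClosed C k 𝒯 X → Weak C 𝒯 (U ∩ ∁ X) →
                    w ∈ U → w ∉ X → λ′ (U ∩ X) < λ′ U
    shrink-strict {X} {U} {w} (_ , sepX , closed) weakOutside w∈U w∉X =
      submod-drop submodXU sepX (≰⇒> notSep)
      where
      notSep : ¬ λ′ (X ∪ U) ≤ k
      notSep = subst (λ Z → ¬ λ′ Z ≤ k) (∪-outside X U)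
        (closed (U ∩ ∁ X) (w , x∈p∩q⁺ (w∈U , x∉p⇒x∈∁p w∉X)) weakOutside (p∩q⊆q U (∁ X)))
      submodXU : λ′ (X ∪ U) + λ′ (U ∩ X) ≤ λ′ X + λ′ U
      submodXU = subst (λ Z → λ′ (X ∪ U) + λ′ Z ≤ λ′ X + λ′ U) (∩-comm X U) (submod C X U)

    shrink : ∀ {X U} → FullyClosed C k 𝒯 X → Weak C 𝒯 (U ∩ ∁ X) → λ′ (U ∩ X) ≤ λ′ U
    shrink {X} {U} fc weakOutside with ⊆-or-escape U X
    ... | inj₁ U⊆X = ≤-reflexive (cong λ′ (⊆-antisym (p∩q⊆p U X) λ x∈U → x∈p∩q⁺ (x∈U , U⊆X x∈U)))
    ... | inj₂ (w , w∈U , w∉X) = <⇒≤ (shrink-strict fc weakOutside w∈U w∉X)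

    shrink₂-strict : ∀ {X₁ X₂ U w} → FullyClosed C k 𝒯 X₁ → FullyClosed C k 𝒯 X₂ →
                     Weak C 𝒯 (U ∩ ∁ X₁) → Weak C 𝒯 ((U ∩ X₁) ∩ ∁ X₂) →
                     w ∈ U → w ∉ X₁ ∩ X₂ → λ′ ((U ∩ X₁) ∩ X₂) < λ′ U
    shrink₂-strict {X₁} {X₂} {U} {w} fc₁ fc₂ weak₁ weak₂ w∈U w∉X₁∩X₂ with w ∈? X₁
    ... | no w∉X₁ = ≤-<-trans (shrink fc₂ weak₂) (shrink-strict fc₁ weak₁ w∈U w∉X₁)
    ... | yes w∈X₁ = <-≤-trans
      (shrink-strict fc₂ weak₂ (x∈p∩q⁺ (w∈U , w∈X₁)) (λ w∈X₂ → w∉X₁∩X₂ (x∈p∩q⁺ (w∈X₁ , w∈X₂))))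
      (shrink fc₁ weak₁)

    module _ (tangle : IsTangle C k 𝒯) where
      open IsTangle tangle using (T2)

      -- A strong set Y with λ(Y) < k lies in no fully closed X ≠ E: by (T2)
      -- Y or ∁ Y is in 𝒯; the first contradicts strength, the second makes
      -- ∁ X ⊆ ∁ Y weak.
      small-strong-escapes : ∀ {Y X w} → Strong C 𝒯 Y → λ′ Y < k →
                             Y ⊆ X → FullyClosed C k 𝒯 X → w ∉ X → Empty.⊥
      small-strong-escapes {Y} strongY λY<k Y⊆X fcX w∉X with T2 Y (<⇒≤-1 λY<k)
      ... | inj₁ Y∈𝒯  = strongY (Y , Y∈𝒯 , ⊆-refl)
      ... | inj₂ ∁Y∈𝒯 = complement-strong fcX w∉X (∁ Y , ∁Y∈𝒯 , p⊆q⇒∁p⊇∁q Y⊆X)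

      maximal⇒fullyClosed : ∀ {X₁ X₂ Y} → FullyClosed C k 𝒯 X₁ → FullyClosed C k 𝒯 X₂ →
                            Strong C 𝒯 Y → Maximal (λ Z → Z ⊆ X₁ ∩ X₂ × Separating C k Z) Y →
                            FullyClosed C k 𝒯 Y
      maximal⇒fullyClosed {X₁} {X₂} {Y} fc₁ fc₂ strongY ((Y⊆I , sepY) , maxY) =
        strongY , sepY , closed
        where
        Y⊆X₁ : Y ⊆ X₁
        Y⊆X₁ = proj₁ ∘ x∈p∩q⁻ X₁ X₂ ∘ Y⊆I
        Y⊆X₂ : Y ⊆ X₂
        Y⊆X₂ = proj₂ ∘ x∈p∩q⁻ X₁ X₂ ∘ Y⊆I
        closed : ∀ W → Nonempty W → Weak C 𝒯 W → W ⊆ ∁ Y → ¬ λ′ (Y ∪ W) ≤ k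
        closed W (w , w∈W) weakW W⊆∁Y sepU = [ small-strong-escapes strongY λY<k Y⊆X₁ fc₁
                                              , small-strong-escapes strongY λY<k Y⊆X₂ fc₂
                                              ]′ (∉∩ X₁ X₂ w∉I)
          where
          U : Subset n
          U = Y ∪ W
          U₂ : Subset n
          U₂ = (U ∩ X₁) ∩ X₂
          weak₁ : Weak C 𝒯 (U ∩ ∁ X₁)
          weak₁ = weak-⊆ (outside-⊆ ⊆-refl Y⊆X₁) weakW
          weak₂ : Weak C 𝒯 ((U ∩ X₁) ∩ ∁ X₂)
          weak₂ = weak-⊆ (outside-⊆ (p∩q⊆p U X₁) Y⊆X₂) weakW
          U₂⊆I : U₂ ⊆ X₁ ∩ X₂
          U₂⊆I x∈U₂ with x∈p∩q⁻ (U ∩ X₁) X₂ x∈U₂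
          ... | x∈U∩X₁ , x∈X₂ = x∈p∩q⁺ (proj₂ (x∈p∩q⁻ U X₁ x∈U∩X₁) , x∈X₂)
          Y⊆U₂ : Y ⊆ U₂
          Y⊆U₂ x∈Y = x∈p∩q⁺ (x∈p∩q⁺ (p⊆p∪q W x∈Y , Y⊆X₁ x∈Y) , Y⊆X₂ x∈Y)
          sepU₂ : λ′ U₂ ≤ k
          sepU₂ = ≤-trans (shrink fc₂ weak₂) (≤-trans (shrink fc₁ weak₁) sepU)
          Y≡U₂ : Y ≡ U₂
          Y≡U₂ = ⊆-antisym Y⊆U₂ (maxY U₂ Y⊆U₂ (U₂⊆I , sepU₂))
          w∈U : w ∈ U
          w∈U = q⊆p∪q Y W w∈W
          -- w ∈ W lies outside Y = U ∩ X₁ ∩ X₂, so it escapes X₁ ∩ X₂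
          w∉I : w ∉ X₁ ∩ X₂
          w∉I w∈I with x∈p∩q⁻ X₁ X₂ w∈I
          ... | w∈X₁ , w∈X₂ = x∈∁p⇒x∉p (W⊆∁Y w∈W)
            (subst (w ∈_) (sym Y≡U₂) (x∈p∩q⁺ (x∈p∩q⁺ (w∈U , w∈X₁) , w∈X₂)))
          λY<k : λ′ Y < k
          λY<k = subst (λ Z → λ′ Z < k) (sym Y≡U₂)
            (<-≤-trans (shrink₂-strict fc₁ fc₂ weak₁ weak₂ w∈U w∉I) sepU)

lemma3p1 : ∀ {n : ℕ} (C : ConnectivitySystem n) (k : ℤ) (𝒯 : Subset n → Set)
    → IsTangle C k 𝒯
    → (X : Subset n) → Strong C 𝒯 X → Separating C k X
    → (X₁ X₂ : Subset n) → FullyClosed C k 𝒯 X₁ → FullyClosed C k 𝒯 X₂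
    → X ⊆ X₁ → X ⊆ X₂
    → ∃ λ Y → FullyClosed C k 𝒯 Y × X ⊆ Y × Y ⊆ (X₁ ∩ X₂)
lemma3p1 {n} C k 𝒯 tangle X strongX sepX X₁ X₂ fc₁ fc₂ X⊆X₁ X⊆X₂ =
  Y , maximal⇒fullyClosed C k 𝒯 tangle fc₁ fc₂ (strong-⊇ C k 𝒯 X⊆Y strongX) maxY , X⊆Y , Y⊆I
  where
  Admissible : Subset n → Set
  Admissible Z = Z ⊆ X₁ ∩ X₂ × Separating C k Z
  X⊆I : X ⊆ X₁ ∩ X₂
  X⊆I x∈X = x∈p∩q⁺ (X⊆X₁ x∈X , X⊆X₂ x∈X)
  climbed : ∃ λ Y → Maximal Admissible Y × X ⊆ Y
  climbed = maximal-above (λ Z → (Z ⊆? X₁ ∩ X₂) ×-dec (λc C Z ≤? k)) (X⊆I , sepX)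
  Y : Subset n
  Y = proj₁ climbed
  maxY : Maximal Admissible Y
  maxY = proj₁ (proj₂ climbed)
  X⊆Y : X ⊆ Y
  X⊆Y = proj₂ (proj₂ climbed)
  Y⊆I : Y ⊆ X₁ ∩ X₂
  Y⊆I = proj₁ (proj₁ maxY)
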